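{- Let $G,H$ be connected graphs with $n$ and $m$ vertices respectively, and $g\ge0$ an integer, such that $\kappa^g(G\square H)$ exists. If $c^g(G\square H)\le \lceil nm/2\rceil$, then $t^{g}(G\square H)=c^g(G\square H)-1$.
   Context: $G\square H$ is the Cartesian product: vertex set $V(G)\times V(H)$, with $(u,v)\sim(u',v')$ iff ($u=u'$ and $vv'\in E(H)$) or ($v=v'$ and $uu'\in E(G)$). For a graph $\Gamma=(V,E)$ and $F\subseteq V$, $F$ is a $g$-good-neighbor conditional faulty set if every vertex of $V\setminus F$ has at least $g$ neighbors in $V\setminus F$; a $g$-good-neighbor cut if moreover $\Gamma-F$ is disconnected. $\kappa^g(\Gamma)$ is the minimum size of a $g$-good-neighbor cut (exists if such a cut exists). PMC model: distinct $F_1,F_2$ are distinguishable iff there exist $u\in F_1\triangle F_2$, $v\notin F_1\cup F_2$ with $uv\in E$. $t^g(\Gamma)$ is the maximum $t$ such that every pair of distinct $g$-good-neighbor conditional faulty sets of size at most $t$ is distinguishable. gc number: for a $g$-good-neighbor cut $X$ and component $C$ of $\Gamma-X$, $C$ is splittable if $V(C)$ partitions into nonempty $A,B$ with $\delta(\Gamma[A]),\delta(\Gamma[B])\ge g$; among such partitions with $|A|\ge|B|$ minimizing $|A|-|B|$ set $a(C)=|A|$. $a(X)=\min a(C)$ over splittable components, $c(X)=$ minimum order of a non-splittable component (minima over empty sets are $+\infty$), and $c^g(\Gamma)=\min_X\{|X|+\min\{a(X),c(X)\}\}$ over all $g$-good-neighbor cuts $X$. -}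

module Defs where

open import Data.Bool using (Bool; true; false; _∧_; _∨_)
open import Data.Nat using (ℕ; _+_; _*_; _∸_; _≤_; ⌈_/2⌉)
open import Data.Fin using (Fin; _≟_; remQuot)
open import Data.Fin.Subset using (Subset; _∈_; _∉_; ∁; _∩_; _∪_; ∣_∣; ⊥; ⊤; Nonempty)
open import Data.Vec using (tabulate)
open import Data.Product using (Σ; ∃; _×_; _,_; proj₁; proj₂)
open import Data.Sum using (_⊎_)
import Data.Empty
open import Relation.Nullary using (¬_)
open import Relation.Nullary.Decidable using (⌊_⌋)
open import Relation.Binary.PropositionalEquality using (_≡_; _≢_; refl; sym; cong₂)
open import Relation.Nullary using (yes; no)

record Graph (n : ℕ) : Set where
  field
    adj     : Fin n → Fin n → Bool
    adj-sym : ∀ u v → adj u v ≡ adj v u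
    adj-irr : ∀ u → adj u u ≡ false
open Graph public

_~⟨_⟩_ : {n : ℕ} → Fin n → Graph n → Fin n → Set
u ~⟨ Γ ⟩ v = adj Γ u v ≡ true

data Reach {n : ℕ} (Γ : Graph n) (S : Subset n) (u : Fin n) : Fin n → Set where
  here : u ∈ S → Reach Γ S u u
  step : ∀ {w v} → Reach Γ S u w → w ~⟨ Γ ⟩ v → v ∈ S → Reach Γ S u v

Connected : {n : ℕ} → Graph n → Set
Connected {n} Γ = ∀ (u v : Fin n) → Reach Γ ⊤ u v

-- Cartesian product G □ H; vertex (u , v) is encoded as combine u v : Fin (n * m),
-- decoded by remQuot.
eqb : {k : ℕ} → Fin k → Fin k → Bool
eqb x y = ⌊ x ≟ y ⌋

eqb-sym : {k : ℕ} (x y : Fin k) → eqb x y ≡ eqb y x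
eqb-sym x y with x ≟ y | y ≟ x
... | yes _ | yes _ = refl
... | no _ | no _ = refl
... | yes p | no q = Data.Empty.⊥-elim (q (sym p))
... | no p | yes q = Data.Empty.⊥-elim (p (sym q))

eqb-refl : {k : ℕ} (x : Fin k) → eqb x x ≡ true
eqb-refl x with x ≟ x
... | yes _ = refl
... | no p = Data.Empty.⊥-elim (p refl)

cartAdj' : {n m : ℕ} → Graph n → Graph m → Fin n × Fin m → Fin n × Fin m → Bool
cartAdj' G H (u , v) (u' , v') = (eqb u u' ∧ adj H v v') ∨ (eqb v v' ∧ adj G u u')

_□_ : {n m : ℕ} → Graph n → Graph m → Graph (n * m)
_□_ {n} {m} G H = record
  { adj = λ i j → cartAdj' G H (remQuot {n} m i) (remQuot {n} m j)
  ; adj-sym = λ i j → lemSym (remQuot {n} m i) (remQuot {n} m j)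
  ; adj-irr = λ i → lemIrr (remQuot {n} m i)
  }
  where
  lemSym : ∀ p q → cartAdj' G H p q ≡ cartAdj' G H q p
  lemSym (u , v) (u' , v') rewrite eqb-sym u u' | eqb-sym v v' | adj-sym H v v' | adj-sym G u u' = refl
  lemIrr : ∀ p → cartAdj' G H p p ≡ false
  lemIrr (u , v) rewrite eqb-refl u | eqb-refl v | adj-irr H v | adj-irr G u = refl

module _ {N : ℕ} (Γ : Graph N) where

  nbrs : Fin N → Subset N
  nbrs v = tabulate (adj Γ v)

  MinDegAtLeast : Subset N → ℕ → Set
  MinDegAtLeast S g = ∀ v → v ∈ S → g ≤ ∣ nbrs v ∩ S ∣

  GoodNeighborFaulty : ℕ → Subset N → Set
  GoodNeighborFaulty g F = MinDegAtLeast (∁ F) g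

  DisconnectedAfter : Subset N → Set
  DisconnectedAfter F = Σ (Fin N) λ u → Σ (Fin N) λ v →
    u ∉ F × v ∉ F × ¬ Reach Γ (∁ F) u v

  GoodNeighborCut : ℕ → Subset N → Set
  GoodNeighborCut g F = GoodNeighborFaulty g F × DisconnectedAfter F

  KappaExists : ℕ → Set
  KappaExists g = Σ (Subset N) (GoodNeighborCut g)

  Distinguishable : Subset N → Subset N → Set
  Distinguishable F₁ F₂ = Σ (Fin N) λ u → Σ (Fin N) λ v →
    ((u ∈ F₁ × u ∉ F₂) ⊎ (u ∉ F₁ × u ∈ F₂)) × v ∉ (F₁ ∪ F₂) × u ~⟨ Γ ⟩ v

  Diagnosable : ℕ → ℕ → Set
  Diagnosable g t = ∀ F₁ F₂ → GoodNeighborFaulty g F₁ → GoodNeighborFaulty g F₂ →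
    ∣ F₁ ∣ ≤ t → ∣ F₂ ∣ ≤ t → F₁ ≢ F₂ → Distinguishable F₁ F₂

  IsTg : ℕ → ℕ → Set
  IsTg g t = Diagnosable g t × (∀ t' → Diagnosable g t' → t' ≤ t)

  IsComponent : Subset N → Subset N → Set
  IsComponent X C = Σ (Fin N) λ v → v ∉ X × (∀ w → (w ∈ C → Reach Γ (∁ X) v w) × (Reach Γ (∁ X) v w → w ∈ C))

  Split : ℕ → Subset N → Subset N → Subset N → Set
  Split g C A B = Nonempty A × Nonempty B × (A ∪ B ≡ C) × (A ∩ B ≡ ⊥) ×
    MinDegAtLeast A g × MinDegAtLeast B g

  Splittable : ℕ → Subset N → Set
  Splittable g C = Σ (Subset N) λ A → Σ (Subset N) λ B → Split g C A B

  IsA : ℕ → Subset N → ℕ → Set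
  IsA g C k = Σ (Subset N) λ A → Σ (Subset N) λ B →
    Split g C A B × ∣ B ∣ ≤ ∣ A ∣ × ∣ A ∣ ≡ k ×
    (∀ A' B' → Split g C A' B' → ∣ B' ∣ ≤ ∣ A' ∣ → ∣ A ∣ ∸ ∣ B ∣ ≤ ∣ A' ∣ ∸ ∣ B' ∣)

  CgCandidate : ℕ → ℕ → Set
  CgCandidate g k = Σ (Subset N) λ X → Σ (Subset N) λ C →
    GoodNeighborCut g X × IsComponent X C ×
    ((¬ Splittable g C × k ≡ ∣ X ∣ + ∣ C ∣) ⊎ (Σ ℕ λ a → IsA g C a × k ≡ ∣ X ∣ + a))

  IsCg : ℕ → ℕ → Set
  IsCg g c = CgCandidate g c × (∀ k → CgCandidate g k → c ≤ k)

{-# OPTIONS --safe #-}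
module Submission where

-- Both bounds compare pairs of faulty sets with partitions of components.  If X
-- is a g-good-neighbor cut, C a component of Γ - X and C = A ⊎ B with
-- δ(A), δ(B) ≥ g (one part may be empty), then X ∪ A and X ∪ B are g-good-neighbor
-- faulty sets differing exactly on C, which no test can separate; hence
-- t^g < |X| + max(|A|, |B|), and the candidates for c^g are of this form.
-- Conversely, if F₁ ≠ F₂ are indistinguishable and g-good, either they cover all
-- N vertices, so max |Fᵢ| ≥ ⌈N/2⌉ ≥ c^g, or F₁ ∩ F₂ is a cut and the component C
-- of a vertex of the symmetric difference lies in F₁ ∪ F₂ and splits as
-- (C ∖ F₂, C ∖ F₁), so c^g ≤ |F₁ ∩ F₂| + max(|C ∖ F₂|, |C ∖ F₁|) ≤ max |Fᵢ|.
-- Either way sets of size below c^g are distinguishable.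

open import Defs
open import Data.Nat using (ℕ; zero; suc; _+_; _*_; _∸_; _≤_; _<_; _⊔_; z≤n; s≤s; ⌈_/2⌉; _≤?_)
open import Data.Nat.Properties
  using ( ≤-refl; ≤-reflexive; ≤-trans; ≤-<-trans; ≤-total; ≰⇒>; <⇒≱; +-suc; +-comm; +-assoc
        ; +-identityʳ; m≤m+n; m≤n+m; +-monoʳ-≤; +-mono-≤; m∸n+n≡m; *-cancelˡ-≤
        ; m≥n⇒m⊔n≡m; ⊔-identityʳ; m≤m⊔n; m≤n⊔m; ⊔-lub; ⊔-mono-≤; +-distribˡ-⊔; ⌈n/2⌉-mono; n≡⌈n+n/2⌉
        ; module ≤-Reasoning )
open import Data.Nat.Induction using (<-rec)
open import Data.Bool using (Bool; true; false)
open import Data.Bool.Properties using () renaming (_≟_ to _≟ᵇ_)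
open import Data.Fin using (Fin) renaming (zero to fzero; suc to fsuc)
open import Data.Fin.Properties using (any?)
open import Data.Fin.Subset using (Subset; _∈_; _∉_; _⊆_; ∁; _∩_; _∪_; ∣_∣; ⊥; ⊤; Nonempty; Empty)
open import Data.Fin.Subset.Properties
  using ( _∈?_; nonempty?; Empty-unique; ∉⊥; ⊥⊆; ∣⊥∣≡0; ∣⊤∣≡n; ⊆-antisym; ⊆-trans; ⊆-reflexive
        ; p⊆q⇒∣p∣≤∣q∣; x∈p⇒∣p-x∣<∣p∣; x∈∁p⇒x∉p; x∉p⇒x∈∁p; p⊆q⇒∁p⊇∁q
        ; x∈p∩q⁺; x∈p∩q⁻; p∩q⊆p; p∩q⊆q; x∈p∪q⁺; x∈p∪q⁻; p⊆p∪q; q⊆p∪q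
        ; ∪-comm; ∩-comm; ∪-identityʳ; ∩-zeroʳ )
open import Data.Vec using (_∷_; []; tabulate)
open import Data.Vec.Properties using ([]=⇒lookup; lookup⇒[]=; lookup∘tabulate)
open import Data.Product using (Σ; ∃; _×_; _,_; proj₁; proj₂)
open import Data.Sum using (_⊎_; inj₁; inj₂; [_,_]′)
open import Data.Empty using (⊥-elim)
open import Relation.Nullary using (¬_; Dec; yes; no; does)
open import Relation.Nullary.Negation using (¬¬-map)
open import Relation.Nullary.Decidable using (decidable-stable; dec-true; ¬¬-excluded-middle; ¬?; _×-dec_; _⊎-dec_)
open import Relation.Binary.PropositionalEquality
  using (_≡_; _≢_; refl; sym; trans; cong; subst; module ≡-Reasoning)

gap-≤⇒≤ : ∀ {a b a' b'} → a + b ≡ a' + b' → b ≤ a → b' ≤ a' → a ∸ b ≤ a' ∸ b' → a ≤ a'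
gap-≤⇒≤ {a} {b} {a'} {b'} sum≡ b≤a b'≤a' gap≤ = *-cancelˡ-≤ 2 (begin
  2 * a                  ≡⟨ twice b≤a ⟩
  (a ∸ b) + (a + b)      ≤⟨ +-mono-≤ gap≤ (≤-reflexive sum≡) ⟩
  (a' ∸ b') + (a' + b')  ≡⟨ sym (twice b'≤a') ⟩
  2 * a'                 ∎)
  where
  open ≤-Reasoning
  twice : ∀ {x y} → y ≤ x → 2 * x ≡ (x ∸ y) + (x + y)
  twice {x} {y} y≤x = begin-equality
    2 * x              ≡⟨ cong (x +_) (+-identityʳ x) ⟩
    x + x              ≡⟨ cong (_+ x) (sym (m∸n+n≡m y≤x)) ⟩
    (x ∸ y) + y + x    ≡⟨ +-assoc (x ∸ y) y x ⟩
    (x ∸ y) + (y + x)  ≡⟨ cong ((x ∸ y) +_) (+-comm y x) ⟩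
    (x ∸ y) + (x + y)  ∎

⌈n/2⌉≤m : ∀ {n m} → n ≤ m + m → ⌈ n /2⌉ ≤ m
⌈n/2⌉≤m {n} {m} n≤m+m = subst (⌈ n /2⌉ ≤_) (sym (n≡⌈n+n/2⌉ m)) (⌈n/2⌉-mono n≤m+m)

<⇒≤∸1 : ∀ {m n} → m < n → m ≤ n ∸ 1
<⇒≤∸1 (s≤s m≤n) = m≤n

n∸1<n : ∀ {n} → 0 < n → n ∸ 1 < n
n∸1<n (s≤s _) = ≤-refl

∣p∪q∣+∣p∩q∣≡∣p∣+∣q∣ : ∀ {n} (p q : Subset n) → ∣ p ∪ q ∣ + ∣ p ∩ q ∣ ≡ ∣ p ∣ + ∣ q ∣
∣p∪q∣+∣p∩q∣≡∣p∣+∣q∣ []          []          = refl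
∣p∪q∣+∣p∩q∣≡∣p∣+∣q∣ (true  ∷ p) (true  ∷ q) =
  cong suc (trans (+-suc ∣ p ∪ q ∣ ∣ p ∩ q ∣)
                  (trans (cong suc (∣p∪q∣+∣p∩q∣≡∣p∣+∣q∣ p q)) (sym (+-suc ∣ p ∣ ∣ q ∣))))
∣p∪q∣+∣p∩q∣≡∣p∣+∣q∣ (true  ∷ p) (false ∷ q) = cong suc (∣p∪q∣+∣p∩q∣≡∣p∣+∣q∣ p q)
∣p∪q∣+∣p∩q∣≡∣p∣+∣q∣ (false ∷ p) (true  ∷ q) =
  trans (cong suc (∣p∪q∣+∣p∩q∣≡∣p∣+∣q∣ p q)) (sym (+-suc ∣ p ∣ ∣ q ∣))
∣p∪q∣+∣p∩q∣≡∣p∣+∣q∣ (false ∷ p) (false ∷ q) = ∣p∪q∣+∣p∩q∣≡∣p∣+∣q∣ p q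

∣p∪q∣≤∣p∣+∣q∣ : ∀ {n} (p q : Subset n) → ∣ p ∪ q ∣ ≤ ∣ p ∣ + ∣ q ∣
∣p∪q∣≤∣p∣+∣q∣ p q = ≤-trans (m≤m+n ∣ p ∪ q ∣ ∣ p ∩ q ∣) (≤-reflexive (∣p∪q∣+∣p∩q∣≡∣p∣+∣q∣ p q))

module _ {n : ℕ} {p q : Subset n} where

  disjoint⇒∩≡⊥ : (∀ {x} → x ∈ p → x ∉ q) → p ∩ q ≡ ⊥
  disjoint⇒∩≡⊥ disjoint = ⊆-antisym (λ x∈p∩q → let x∈p , x∈q = x∈p∩q⁻ p q x∈p∩q in
                                                 ⊥-elim (disjoint x∈p x∈q)) ⊥⊆

  ∩≡⊥⇒disjoint : p ∩ q ≡ ⊥ → ∀ {x} → x ∈ p → x ∉ q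
  ∩≡⊥⇒disjoint p∩q≡⊥ x∈p x∈q = ∉⊥ (subst (_ ∈_) p∩q≡⊥ (x∈p∩q⁺ (x∈p , x∈q)))

  ∩≡⊥⇒∣p∣+∣q∣≡∣p∪q∣ : p ∩ q ≡ ⊥ → ∣ p ∣ + ∣ q ∣ ≡ ∣ p ∪ q ∣
  ∩≡⊥⇒∣p∣+∣q∣≡∣p∪q∣ p∩q≡⊥ = begin
    ∣ p ∣ + ∣ q ∣             ≡⟨ sym (∣p∪q∣+∣p∩q∣≡∣p∣+∣q∣ p q) ⟩
    ∣ p ∪ q ∣ + ∣ p ∩ q ∣     ≡⟨ cong (λ r → ∣ p ∪ q ∣ + ∣ r ∣) p∩q≡⊥ ⟩
    ∣ p ∪ q ∣ + ∣ ⊥ {n} ∣     ≡⟨ cong (∣ p ∪ q ∣ +_) (∣⊥∣≡0 n) ⟩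
    ∣ p ∪ q ∣ + 0             ≡⟨ +-identityʳ ∣ p ∪ q ∣ ⟩
    ∣ p ∪ q ∣                 ∎
    where open ≡-Reasoning

  disjoint-⊆⇒∣p∣+∣q∣≤ : ∀ {r} → p ⊆ r → q ⊆ r → (∀ {x} → x ∈ p → x ∉ q) → ∣ p ∣ + ∣ q ∣ ≤ ∣ r ∣
  disjoint-⊆⇒∣p∣+∣q∣≤ p⊆r q⊆r disjoint =
    ≤-trans (≤-reflexive (∩≡⊥⇒∣p∣+∣q∣≡∣p∪q∣ (disjoint⇒∩≡⊥ disjoint)))
            (p⊆q⇒∣p∣≤∣q∣ (λ x∈p∪q → [ p⊆r , q⊆r ]′ (x∈p∪q⁻ p q x∈p∪q)))

∣p∩q∣+∣r∩∁q∣≤∣p∣ : ∀ {n} {p q r : Subset n} → r ⊆ p ∪ q → ∣ p ∩ q ∣ + ∣ r ∩ ∁ q ∣ ≤ ∣ p ∣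
∣p∩q∣+∣r∩∁q∣≤∣p∣ {p = p} {q} {r} r⊆p∪q = disjoint-⊆⇒∣p∣+∣q∣≤ (p∩q⊆p p q)
  (λ x∈ → let x∈r , x∈∁q = x∈p∩q⁻ r _ x∈ in
          [ (λ x∈p → x∈p) , (λ x∈q → ⊥-elim (x∈∁p⇒x∉p x∈∁q x∈q)) ]′ (x∈p∪q⁻ p q (r⊆p∪q x∈r)))
  (λ x∈p∩q x∈ → x∈∁p⇒x∉p (proj₂ (x∈p∩q⁻ r _ x∈)) (p∩q⊆q p q x∈p∩q))

∣p∩q∣+∣r∩∁p∣≤∣q∣ : ∀ {n} {p q r : Subset n} → r ⊆ p ∪ q → ∣ p ∩ q ∣ + ∣ r ∩ ∁ p ∣ ≤ ∣ q ∣
∣p∩q∣+∣r∩∁p∣≤∣q∣ {p = p} {q} {r} r⊆p∪q = subst (λ s → ∣ s ∣ + ∣ r ∩ ∁ p ∣ ≤ ∣ q ∣) (∩-comm q p)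
  (∣p∩q∣+∣r∩∁q∣≤∣p∣ (⊆-trans r⊆p∪q (⊆-reflexive (∪-comm p q))))

∈p∪q⇒⌈n/2⌉≤∣p∣⊔∣q∣ : ∀ {n} {p q : Subset n} → (∀ x → x ∈ p ∪ q) → ⌈ n /2⌉ ≤ ∣ p ∣ ⊔ ∣ q ∣
∈p∪q⇒⌈n/2⌉≤∣p∣⊔∣q∣ {n} {p} {q} ∈p∪q = ⌈n/2⌉≤m (begin
  n                                ≡⟨ sym (∣⊤∣≡n n) ⟩
  ∣ ⊤ {n} ∣                        ≤⟨ p⊆q⇒∣p∣≤∣q∣ {p = ⊤} (λ {x} _ → ∈p∪q x) ⟩
  ∣ p ∪ q ∣                        ≤⟨ ∣p∪q∣≤∣p∣+∣q∣ p q ⟩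
  ∣ p ∣ + ∣ q ∣                    ≤⟨ +-mono-≤ (m≤m⊔n ∣ p ∣ ∣ q ∣) (m≤n⊔m ∣ p ∣ ∣ q ∣) ⟩
  (∣ p ∣ ⊔ ∣ q ∣) + (∣ p ∣ ⊔ ∣ q ∣)  ∎)
  where open ≤-Reasoning

∉-∪⁻ : ∀ {n} {x : Fin n} {p q} → x ∉ p ∪ q → x ∉ p × x ∉ q
∉-∪⁻ x∉p∪q = (λ x∈p → x∉p∪q (x∈p∪q⁺ (inj₁ x∈p))) , (λ x∈q → x∉p∪q (x∈p∪q⁺ (inj₂ x∈q)))

Empty⇒∣p∣≡0 : ∀ {n} {p : Subset n} → Empty p → ∣ p ∣ ≡ 0
Empty⇒∣p∣≡0 {n} empty = trans (cong ∣_∣ (Empty-unique empty)) (∣⊥∣≡0 n)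

Nonempty⇒0<∣p∣ : ∀ {n} {p : Subset n} → Nonempty p → 0 < ∣ p ∣
Nonempty⇒0<∣p∣ (_ , x∈p) = ≤-<-trans z≤n (x∈p⇒∣p-x∣<∣p∣ x∈p)

∈-tabulate⁻ : ∀ {n} {f : Fin n → Bool} {x} → x ∈ tabulate f → f x ≡ true
∈-tabulate⁻ {f = f} {x} x∈ = trans (sym (lookup∘tabulate f x)) ([]=⇒lookup x∈)

∈-tabulate⁺ : ∀ {n} {f : Fin n → Bool} {x} → f x ≡ true → x ∈ tabulate f
∈-tabulate⁺ {f = f} {x} fx≡true = lookup⇒[]= x (tabulate f) (trans (lookup∘tabulate f x) fx≡true)

¬¬-∀-Fin : ∀ {n} {P : Fin n → Set} → (∀ i → ¬ ¬ P i) → ¬ ¬ (∀ i → P i)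
¬¬-∀-Fin {zero}  _     ¬∀ = ¬∀ λ ()
¬¬-∀-Fin {suc n} ¬¬P ¬∀ =
  ¬¬P fzero λ P0 → ¬¬-∀-Fin (λ i → ¬¬P (fsuc i)) λ Psuc → ¬∀ λ { fzero → P0 ; (fsuc i) → Psuc i }

¬¬-least : ∀ {P : ℕ → Set} {n} → P n → ¬ ¬ (∃ λ m → P m × ∀ k → P k → m ≤ k)
¬¬-least {P} {n} = <-rec (λ n → P n → ¬ ¬ Least) least n
  where
  Least : Set
  Least = ∃ λ m → P m × ∀ k → P k → m ≤ k
  least : ∀ n → (∀ {k} → k < n → P k → ¬ ¬ Least) → P n → ¬ ¬ Least
  least n below Pn ¬least =
    ¬least (n , Pn , λ k Pk → decidable-stable (n ≤? k) λ n≰k → below (≰⇒> n≰k) Pk ¬least)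

module _ {N : ℕ} (Γ : Graph N) where

  reach-end : ∀ {S u w} → Reach Γ S u w → w ∈ S
  reach-end (here u∈S)     = u∈S
  reach-end (step _ _ w∈S) = w∈S

  degree-mono : ∀ {v S T} → (∀ {w} → v ~⟨ Γ ⟩ w → w ∈ S → w ∈ T) →
                ∣ nbrs Γ v ∩ S ∣ ≤ ∣ nbrs Γ v ∩ T ∣
  degree-mono S⇒T = p⊆q⇒∣p∣≤∣q∣ λ w∈ →
    let w∈nbrs , w∈S = x∈p∩q⁻ _ _ w∈ in x∈p∩q⁺ (w∈nbrs , S⇒T (∈-tabulate⁻ w∈nbrs) w∈S)

  ComponentOf : Subset N → Fin N → Subset N → Set
  ComponentOf X u C = ∀ w → (w ∈ C → Reach Γ (∁ X) u w) × (Reach Γ (∁ X) u w → w ∈ C)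

  -- Reachability need not be decidable, but excluded middle for each of the
  -- finitely many vertices is available under a double negation.
  ¬¬-componentOf : ∀ X u → ¬ ¬ ∃ (ComponentOf X u)
  ¬¬-componentOf X u = ¬¬-map component (¬¬-∀-Fin λ w → ¬¬-excluded-middle)
    where
    component : (∀ w → Dec (Reach Γ (∁ X) u w)) → ∃ (ComponentOf X u)
    component reach? = tabulate (λ w → does (reach? w)) , λ w →
      (λ w∈C → does-true (reach? w) (∈-tabulate⁻ w∈C)) , (λ r → ∈-tabulate⁺ (dec-true (reach? w) r))
      where
      does-true : ∀ {P : Set} (P? : Dec P) → does P? ≡ true → P
      does-true (yes p) _ = p
      does-true (no _) ()

  module _ {X C : Subset N} (comp : IsComponent Γ X C) where

    component-∉ : ∀ {w} → w ∈ C → w ∉ X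
    component-∉ {w} w∈C = x∈∁p⇒x∉p (reach-end (proj₁ (proj₂ (proj₂ comp) w) w∈C))

    component-closed : ∀ {w z} → w ∈ C → w ~⟨ Γ ⟩ z → z ∉ X → z ∈ C
    component-closed {w} {z} w∈C w~z z∉X =
      proj₂ (spec z) (step (proj₁ (spec w) w∈C) w~z (x∉p⇒x∈∁p z∉X))
      where spec = proj₂ (proj₂ comp)

    component-nonempty : Nonempty C
    component-nonempty = let v , v∉X , spec = comp in v , proj₂ (spec v) (here (x∉p⇒x∈∁p v∉X))

    component-minDeg : ∀ {g F} → X ⊆ F → GoodNeighborFaulty Γ g F → MinDegAtLeast Γ (C ∩ ∁ F) g
    component-minDeg X⊆F F-good v v∈ =
      ≤-trans (F-good v v∈∁F) (degree-mono λ v~w w∈∁F →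
        x∈p∩q⁺ (component-closed v∈C v~w (λ w∈X → x∈∁p⇒x∉p w∈∁F (X⊆F w∈X)) , w∈∁F))
      where
      v∈C = proj₁ (x∈p∩q⁻ C _ v∈)
      v∈∁F = proj₂ (x∈p∩q⁻ C _ v∈)

  SymDiff : Subset N → Subset N → Fin N → Set
  SymDiff F₁ F₂ u = (u ∈ F₁ × u ∉ F₂) ⊎ (u ∉ F₁ × u ∈ F₂)

  symDiff? : ∀ F₁ F₂ u → Dec (SymDiff F₁ F₂ u)
  symDiff? F₁ F₂ u = ((u ∈? F₁) ×-dec ¬? (u ∈? F₂)) ⊎-dec (¬? (u ∈? F₁) ×-dec (u ∈? F₂))

  distinguishable? : ∀ F₁ F₂ → Dec (Distinguishable Γ F₁ F₂)
  distinguishable? F₁ F₂ = any? λ u → any? λ w →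
    symDiff? F₁ F₂ u ×-dec (¬? (w ∈? F₁ ∪ F₂) ×-dec (adj Γ u w ≟ᵇ true))

  module _ {F₁ F₂ : Subset N} where

    ≢⇒symDiff : F₁ ≢ F₂ → ∃ (SymDiff F₁ F₂)
    ≢⇒symDiff F₁≢F₂ = decidable-stable (any? (symDiff? F₁ F₂)) λ none →
      F₁≢F₂ (⊆-antisym (λ {x} x∈F₁ → decidable-stable (x ∈? F₂) λ x∉F₂ → none (x , inj₁ (x∈F₁ , x∉F₂)))
                       (λ {x} x∈F₂ → decidable-stable (x ∈? F₁) λ x∉F₁ → none (x , inj₂ (x∉F₁ , x∈F₂))))

    symDiff⇒∈∪ : ∀ {x} → SymDiff F₁ F₂ x → x ∈ F₁ ∪ F₂
    symDiff⇒∈∪ (inj₁ (x∈F₁ , _)) = x∈p∪q⁺ (inj₁ x∈F₁)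
    symDiff⇒∈∪ (inj₂ (_ , x∈F₂)) = x∈p∪q⁺ (inj₂ x∈F₂)

    symDiff⇒∉∩ : ∀ {x} → SymDiff F₁ F₂ x → x ∉ F₁ ∩ F₂
    symDiff⇒∉∩ (inj₁ (_ , x∉F₂)) x∈∩ = x∉F₂ (proj₂ (x∈p∩q⁻ F₁ F₂ x∈∩))
    symDiff⇒∉∩ (inj₂ (x∉F₁ , _)) x∈∩ = x∉F₁ (proj₁ (x∈p∩q⁻ F₁ F₂ x∈∩))

    ∪∖∩⇒symDiff : ∀ {x} → x ∈ F₁ ∪ F₂ → x ∉ F₁ ∩ F₂ → SymDiff F₁ F₂ x
    ∪∖∩⇒symDiff x∈∪ x∉∩ with x∈p∪q⁻ F₁ F₂ x∈∪
    ... | inj₁ x∈F₁ = inj₁ (x∈F₁ , λ x∈F₂ → x∉∩ (x∈p∩q⁺ (x∈F₁ , x∈F₂)))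
    ... | inj₂ x∈F₂ = inj₂ ((λ x∈F₁ → x∉∩ (x∈p∩q⁺ (x∈F₁ , x∈F₂))) , x∈F₂)

    symDiff-≢ : ∀ {x} → SymDiff F₁ F₂ x → F₁ ≢ F₂
    symDiff-≢ (inj₁ (x∈F₁ , x∉F₂)) refl = x∉F₂ x∈F₁
    symDiff-≢ (inj₂ (x∉F₁ , x∈F₂)) refl = x∉F₁ x∈F₂

    -- Leaving F₁ ∪ F₂ from F₁ ∩ F₂'s complement would cross an edge out of the
    -- symmetric difference, which is exactly a distinguishing test.
    indistinguishable-reach : ¬ Distinguishable Γ F₁ F₂ → ∀ {u w} →
      Reach Γ (∁ (F₁ ∩ F₂)) u w → u ∈ F₁ ∪ F₂ → w ∈ F₁ ∪ F₂
    indistinguishable-reach indist (here _) u∈∪ = u∈∪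
    indistinguishable-reach indist {w = w} (step {w'} r w'~w _) u∈∪ =
      decidable-stable (w ∈? F₁ ∪ F₂) λ w∉∪ →
        indist (w' , w , ∪∖∩⇒symDiff (indistinguishable-reach indist r u∈∪) (x∈∁p⇒x∉p (reach-end r)) ,
                w∉∪ , w'~w)

    component-indistinguishable : ∀ {X C} → IsComponent Γ X C → (∀ {u} → SymDiff F₁ F₂ u → u ∈ C) →
      X ∪ C ⊆ F₁ ∪ F₂ → ¬ Distinguishable Γ F₁ F₂
    component-indistinguishable comp symDiff⊆C X∪C⊆ (u , w , u∈symDiff , w∉∪ , u~w) =
      w∉∪ (X∪C⊆ (x∈p∪q⁺ (inj₂ (component-closed comp (symDiff⊆C u∈symDiff) u~w
        (λ w∈X → w∉∪ (X∪C⊆ (x∈p∪q⁺ (inj₁ w∈X))))))))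

  module _ {X C A B : Subset N} (A∪B≡C : A ∪ B ≡ C) where

    part-⊆-symDiff : IsComponent Γ X C → A ∩ B ≡ ⊥ → ∀ {x} → x ∈ C → SymDiff (X ∪ A) (X ∪ B) x
    part-⊆-symDiff comp A∩B≡⊥ {x} x∈C with x∈p∪q⁻ A B (subst (x ∈_) (sym A∪B≡C) x∈C)
    ... | inj₁ x∈A = inj₁ (x∈p∪q⁺ (inj₂ x∈A) , λ x∈X∪B →
            [ component-∉ comp x∈C , ∩≡⊥⇒disjoint A∩B≡⊥ x∈A ]′ (x∈p∪q⁻ X B x∈X∪B))
    ... | inj₂ x∈B = inj₂ ((λ x∈X∪A →
            [ component-∉ comp x∈C , (λ x∈A → ∩≡⊥⇒disjoint A∩B≡⊥ x∈A x∈B) ]′ (x∈p∪q⁻ X A x∈X∪A)) ,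
            x∈p∪q⁺ (inj₂ x∈B))

    symDiff-⊆-part : ∀ {x} → SymDiff (X ∪ A) (X ∪ B) x → x ∈ C
    symDiff-⊆-part (inj₁ (x∈X∪A , x∉X∪B)) =
      [ (λ x∈X → ⊥-elim (x∉X∪B (x∈p∪q⁺ (inj₁ x∈X)))) , ⊆-trans (p⊆p∪q B) (⊆-reflexive A∪B≡C) ]′
        (x∈p∪q⁻ X A x∈X∪A)
    symDiff-⊆-part (inj₂ (x∉X∪A , x∈X∪B)) =
      [ (λ x∈X → ⊥-elim (x∉X∪A (x∈p∪q⁺ (inj₁ x∈X)))) , ⊆-trans (q⊆p∪q A B) (⊆-reflexive A∪B≡C) ]′
        (x∈p∪q⁻ X B x∈X∪B)

  module _ (g : ℕ) where

    GoodPartition : Subset N → Subset N → Subset N → Set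
    GoodPartition C A B = (A ∪ B ≡ C) × (A ∩ B ≡ ⊥) × MinDegAtLeast Γ A g × MinDegAtLeast Γ B g

    partition-swap : ∀ {C A B} → GoodPartition C A B → GoodPartition C B A
    partition-swap {C} {A} {B} (A∪B≡C , A∩B≡⊥ , A-deg , B-deg) =
      trans (∪-comm B A) A∪B≡C , trans (∩-comm B A) A∩B≡⊥ , B-deg , A-deg

    split-swap : ∀ {C A B} → Split Γ g C A B → Split Γ g C B A
    split-swap (A≠∅ , B≠∅ , part) = B≠∅ , A≠∅ , partition-swap part

    partition-size : ∀ {C A B} → GoodPartition C A B → ∣ A ∣ + ∣ B ∣ ≡ ∣ C ∣
    partition-size (A∪B≡C , A∩B≡⊥ , _) = trans (∩≡⊥⇒∣p∣+∣q∣≡∣p∪q∣ A∩B≡⊥) (cong ∣_∣ A∪B≡C)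

    proper-or-∣C∣≤⊔ : ∀ {C A B} → GoodPartition C A B → Split Γ g C A B ⊎ ∣ C ∣ ≤ ∣ A ∣ ⊔ ∣ B ∣
    proper-or-∣C∣≤⊔ {C} {A} {B} part with nonempty? A | nonempty? B
    ... | yes A≠∅ | yes B≠∅ = inj₁ (A≠∅ , B≠∅ , part)
    ... | no A=∅  | _       = inj₂ (begin
      ∣ C ∣          ≡⟨ sym (partition-size part) ⟩
      ∣ A ∣ + ∣ B ∣  ≡⟨ cong (_+ ∣ B ∣) (Empty⇒∣p∣≡0 A=∅) ⟩
      ∣ B ∣          ≤⟨ m≤n⊔m ∣ A ∣ ∣ B ∣ ⟩
      ∣ A ∣ ⊔ ∣ B ∣  ∎)
      where open ≤-Reasoning
    ... | yes _   | no B=∅  = inj₂ (begin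
      ∣ C ∣          ≡⟨ sym (partition-size part) ⟩
      ∣ A ∣ + ∣ B ∣  ≡⟨ cong (∣ A ∣ +_) (Empty⇒∣p∣≡0 B=∅) ⟩
      ∣ A ∣ + 0      ≡⟨ +-identityʳ ∣ A ∣ ⟩
      ∣ A ∣          ≤⟨ m≤m⊔n ∣ A ∣ ∣ B ∣ ⟩
      ∣ A ∣ ⊔ ∣ B ∣  ∎)
      where open ≤-Reasoning

    IsA-≤ : ∀ {C a A B} → IsA Γ g C a → Split Γ g C A B → ∣ B ∣ ≤ ∣ A ∣ → a ≤ ∣ A ∣
    IsA-≤ {A = A} {B} (_ , _ , (_ , _ , part₀) , B₀≤A₀ , refl , most-balanced) split@(_ , _ , part) B≤A =
      gap-≤⇒≤ (trans (partition-size part₀) (sym (partition-size part))) B₀≤A₀ B≤A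
              (most-balanced A B split B≤A)

    IsA-≤-∣C∣ : ∀ {C a} → IsA Γ g C a → a ≤ ∣ C ∣
    IsA-≤-∣C∣ (A , B , (_ , _ , part) , _ , refl , _) = ≤-trans (m≤m+n ∣ A ∣ ∣ B ∣) (≤-reflexive (partition-size part))

    IsA-≤-⊔ : ∀ {C a A B} → IsA Γ g C a → GoodPartition C A B → a ≤ ∣ A ∣ ⊔ ∣ B ∣
    IsA-≤-⊔ {A = A} {B} isA part with proper-or-∣C∣≤⊔ part
    ... | inj₂ ∣C∣≤⊔ = ≤-trans (IsA-≤-∣C∣ isA) ∣C∣≤⊔
    ... | inj₁ split with ≤-total ∣ B ∣ ∣ A ∣
    ...   | inj₁ B≤A = ≤-trans (IsA-≤ isA split B≤A) (m≤m⊔n ∣ A ∣ ∣ B ∣)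
    ...   | inj₂ A≤B = ≤-trans (IsA-≤ isA (split-swap split) A≤B) (m≤n⊔m ∣ A ∣ ∣ B ∣)

    ¬¬-IsA : ∀ {C} → Splittable Γ g C → ¬ ¬ ∃ (IsA Γ g C)
    ¬¬-IsA {C} (A , B , split) = ¬¬-map most-balanced (¬¬-least (proj₂ oriented))
      where
      Gap : ℕ → Set
      Gap d = Σ (Subset N) λ A → Σ (Subset N) λ B → Split Γ g C A B × ∣ B ∣ ≤ ∣ A ∣ × ∣ A ∣ ∸ ∣ B ∣ ≡ d
      oriented : ∃ Gap
      oriented with ≤-total ∣ B ∣ ∣ A ∣
      ... | inj₁ B≤A = _ , A , B , split , B≤A , refl
      ... | inj₂ A≤B = _ , B , A , split-swap split , A≤B , refl
      most-balanced : (∃ λ d → Gap d × ∀ k → Gap k → d ≤ k) → ∃ (IsA Γ g C)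
      most-balanced (_ , (A , B , split , B≤A , refl) , least) =
        ∣ A ∣ , A , B , split , B≤A , refl , λ A' B' split' B'≤A' → least _ (A' , B' , split' , B'≤A' , refl)

    candidate-pos : ∀ {k} → CgCandidate Γ g k → 0 < k
    candidate-pos (X , C , _ , comp , inj₁ (_ , refl)) =
      ≤-trans (Nonempty⇒0<∣p∣ (component-nonempty comp)) (m≤n+m ∣ C ∣ ∣ X ∣)
    candidate-pos (X , _ , _ , _ , inj₂ (_ , (A , _ , (A≠∅ , _) , _ , refl , _) , refl)) =
      ≤-trans (Nonempty⇒0<∣p∣ A≠∅) (m≤n+m ∣ A ∣ ∣ X ∣)

    -- A proper partition is dominated by the candidate |X| + a(C), an improper
    -- one (a part empty) by |X| + |C|.
    cg-≤-partition : ∀ {c X C A B} → IsCg Γ g c → GoodNeighborCut Γ g X → IsComponent Γ X C →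
      GoodPartition C A B → c ≤ ∣ X ∣ + (∣ A ∣ ⊔ ∣ B ∣)
    cg-≤-partition {c} {X} {C} {A} {B} (_ , minimal) cut comp part =
      decidable-stable (c ≤? ∣ X ∣ + (∣ A ∣ ⊔ ∣ B ∣)) λ c≰ → ¬¬-excluded-middle λ where
        (no ¬split) → c≰ (≤-trans (minimal _ (X , C , cut , comp , inj₁ (¬split , refl)))
                                  (+-monoʳ-≤ ∣ X ∣ (∣C∣≤⊔ ¬split)))
        (yes split) → ¬¬-IsA split λ (a , isA) →
          c≰ (≤-trans (minimal _ (X , C , cut , comp , inj₂ (a , isA , refl))) (+-monoʳ-≤ ∣ X ∣ (IsA-≤-⊔ isA part)))
      where
      ∣C∣≤⊔ : ¬ Splittable Γ g C → ∣ C ∣ ≤ ∣ A ∣ ⊔ ∣ B ∣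
      ∣C∣≤⊔ ¬split with proper-or-∣C∣≤⊔ part
      ... | inj₁ split  = ⊥-elim (¬split (_ , _ , split))
      ... | inj₂ ∣C∣≤⊔′ = ∣C∣≤⊔′

    ∩-faulty : ∀ {F₁ F₂} → GoodNeighborFaulty Γ g F₁ → GoodNeighborFaulty Γ g F₂ →
      GoodNeighborFaulty Γ g (F₁ ∩ F₂)
    ∩-faulty {F₁} {F₂} F₁-good F₂-good v v∈ with v ∈? F₁
    ... | yes v∈F₁ = ≤-trans (F₂-good v (x∉p⇒x∈∁p λ v∈F₂ → x∈∁p⇒x∉p v∈ (x∈p∩q⁺ (v∈F₁ , v∈F₂))))
                             (degree-mono λ _ → p⊆q⇒∁p⊇∁q (p∩q⊆q F₁ F₂))
    ... | no v∉F₁  = ≤-trans (F₁-good v (x∉p⇒x∈∁p v∉F₁)) (degree-mono λ _ → p⊆q⇒∁p⊇∁q (p∩q⊆p F₁ F₂))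

    ∪-part-faulty : ∀ {X C A B} → GoodNeighborFaulty Γ g X → IsComponent Γ X C →
      A ∪ B ≡ C → A ∩ B ≡ ⊥ → MinDegAtLeast Γ B g → GoodNeighborFaulty Γ g (X ∪ A)
    ∪-part-faulty {X} {C} {A} {B} X-good comp A∪B≡C A∩B≡⊥ B-deg v v∈ with v ∈? C
    ... | yes v∈C = ≤-trans (B-deg v v∈B) (degree-mono λ _ w∈B → x∉p⇒x∈∁p λ w∈X∪A →
            [ component-∉ comp (B⊆C w∈B) , (λ w∈A → ∩≡⊥⇒disjoint A∩B≡⊥ w∈A w∈B) ]′ (x∈p∪q⁻ X A w∈X∪A))
      where
      B⊆C = ⊆-trans (q⊆p∪q A B) (⊆-reflexive A∪B≡C)
      v∉X∪A = ∉-∪⁻ (x∈∁p⇒x∉p v∈)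
      v∈B = [ (λ v∈A → ⊥-elim (proj₂ v∉X∪A v∈A)) , (λ v∈B → v∈B) ]′ (x∈p∪q⁻ A B (subst (v ∈_) (sym A∪B≡C) v∈C))
    ... | no v∉C = ≤-trans (X-good v (x∉p⇒x∈∁p v∉X)) (degree-mono λ {w} v~w w∈∁X → x∉p⇒x∈∁p λ w∈X∪A →
            [ x∈∁p⇒x∉p w∈∁X ,
              (λ w∈A → v∉C (component-closed comp (A⊆C w∈A) (trans (adj-sym Γ w v) v~w) v∉X)) ]′ (x∈p∪q⁻ X A w∈X∪A))
      where
      A⊆C = ⊆-trans (p⊆p∪q B) (⊆-reflexive A∪B≡C)
      v∉X = proj₁ (∉-∪⁻ (x∈∁p⇒x∉p v∈))

    diagnosable-< : ∀ {t X C A B} → Diagnosable Γ g t → GoodNeighborFaulty Γ g X → IsComponent Γ X C →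
      GoodPartition C A B → t < ∣ X ∣ + (∣ A ∣ ⊔ ∣ B ∣)
    diagnosable-< {t} {X} {C} {A} {B} diagnosable X-good comp (A∪B≡C , A∩B≡⊥ , A-deg , B-deg) =
      ≰⇒> λ bound →
        component-indistinguishable comp symDiff⊆C X∪C⊆
          (diagnosable (X ∪ A) (X ∪ B)
            (∪-part-faulty X-good comp A∪B≡C A∩B≡⊥ B-deg)
            (∪-part-faulty X-good comp B∪A≡C B∩A≡⊥ A-deg)
            (≤-trans (∣p∪q∣≤∣p∣+∣q∣ X A) (≤-trans (+-monoʳ-≤ ∣ X ∣ (m≤m⊔n ∣ A ∣ ∣ B ∣)) bound))
            (≤-trans (∣p∪q∣≤∣p∣+∣q∣ X B) (≤-trans (+-monoʳ-≤ ∣ X ∣ (m≤n⊔m ∣ A ∣ ∣ B ∣)) bound))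
            (symDiff-≢ (C⊆symDiff (proj₂ (component-nonempty comp)))))
      where
      B∪A≡C = trans (∪-comm B A) A∪B≡C
      B∩A≡⊥ = trans (∩-comm B A) A∩B≡⊥
      C⊆symDiff = part-⊆-symDiff A∪B≡C comp A∩B≡⊥
      symDiff⊆C = symDiff-⊆-part A∪B≡C
      X∪C⊆ : X ∪ C ⊆ (X ∪ A) ∪ (X ∪ B)
      X∪C⊆ x∈X∪C with x∈p∪q⁻ X C x∈X∪C
      ... | inj₁ x∈X = x∈p∪q⁺ (inj₁ (x∈p∪q⁺ (inj₁ x∈X)))
      ... | inj₂ x∈C = symDiff⇒∈∪ (C⊆symDiff x∈C)

    whole-partition : ∀ {X C} → GoodNeighborFaulty Γ g X → IsComponent Γ X C → GoodPartition C C ⊥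
    whole-partition {X} {C} X-good comp =
      ∪-identityʳ C , ∩-zeroʳ C ,
      subst (λ D → MinDegAtLeast Γ D g) C∩∁X≡C (component-minDeg comp (λ x∈X → x∈X) X-good) ,
      (λ v v∈⊥ → ⊥-elim (∉⊥ v∈⊥))
      where
      C∩∁X≡C = ⊆-antisym (p∩q⊆p C (∁ X)) (λ x∈C → x∈p∩q⁺ (x∈C , x∉p⇒x∈∁p (component-∉ comp x∈C)))

    diagnosable-<-candidate : ∀ {t k} → Diagnosable Γ g t → CgCandidate Γ g k → t < k
    diagnosable-<-candidate {t} diagnosable (X , C , (X-good , _) , comp , inj₁ (_ , refl)) =
      subst (λ m → t < ∣ X ∣ + m) (trans (cong (∣ C ∣ ⊔_) (∣⊥∣≡0 N)) (⊔-identityʳ ∣ C ∣))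
        (diagnosable-< diagnosable X-good comp (whole-partition X-good comp))
    diagnosable-<-candidate {t} diagnosable
      (X , C , (X-good , _) , comp , inj₂ (_ , (A , B , (_ , _ , part) , B≤A , refl , _) , refl)) =
      subst (λ m → t < ∣ X ∣ + m) (m≥n⇒m⊔n≡m B≤A) (diagnosable-< diagnosable X-good comp part)

    module _ {F₁ F₂ : Subset N} (F₁-good : GoodNeighborFaulty Γ g F₁) (F₂-good : GoodNeighborFaulty Γ g F₂) where

      indistinguishable-cut : ¬ Distinguishable Γ F₁ F₂ → ∀ {u w} → SymDiff F₁ F₂ u → w ∉ F₁ ∪ F₂ →
        GoodNeighborCut Γ g (F₁ ∩ F₂)
      indistinguishable-cut indist {u} {w} u∈symDiff w∉∪ =
        ∩-faulty F₁-good F₂-good ,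
        u , w , symDiff⇒∉∩ u∈symDiff , (λ w∈∩ → w∉∪ (x∈p∪q⁺ (inj₁ (p∩q⊆p F₁ F₂ w∈∩)))) ,
        λ r → w∉∪ (indistinguishable-reach indist r (symDiff⇒∈∪ u∈symDiff))

      indistinguishable-partition : ∀ {C} → IsComponent Γ (F₁ ∩ F₂) C → C ⊆ F₁ ∪ F₂ →
        GoodPartition C (C ∩ ∁ F₂) (C ∩ ∁ F₁)
      indistinguishable-partition {C} comp C⊆∪ =
        ⊆-antisym (λ x∈ → [ p∩q⊆p C (∁ F₂) , p∩q⊆p C (∁ F₁) ]′ (x∈p∪q⁻ _ _ x∈)) C⊆ ,
        disjoint⇒∩≡⊥ (λ x∈C∖F₂ x∈C∖F₁ →
          let x∈C , x∈∁F₂ = x∈p∩q⁻ C _ x∈C∖F₂ in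
          [ x∈∁p⇒x∉p (proj₂ (x∈p∩q⁻ C _ x∈C∖F₁)) , x∈∁p⇒x∉p x∈∁F₂ ]′ (x∈p∪q⁻ F₁ F₂ (C⊆∪ x∈C))) ,
        component-minDeg comp (p∩q⊆q F₁ F₂) F₂-good ,
        component-minDeg comp (p∩q⊆p F₁ F₂) F₁-good
        where
        C⊆ : C ⊆ (C ∩ ∁ F₂) ∪ (C ∩ ∁ F₁)
        C⊆ {x} x∈C with x ∈? F₂
        ... | no x∉F₂  = x∈p∪q⁺ (inj₁ (x∈p∩q⁺ (x∈C , x∉p⇒x∈∁p x∉F₂)))
        ... | yes x∈F₂ = x∈p∪q⁺ (inj₂ (x∈p∩q⁺ (x∈C , x∉p⇒x∈∁p λ x∈F₁ →
                           component-∉ comp x∈C (x∈p∩q⁺ (x∈F₁ , x∈F₂)))))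

      cg-≤-indistinguishable : ∀ {c} → IsCg Γ g c → c ≤ ⌈ N /2⌉ → F₁ ≢ F₂ → ¬ Distinguishable Γ F₁ F₂ →
        c ≤ ∣ F₁ ∣ ⊔ ∣ F₂ ∣
      cg-≤-indistinguishable {c} isCg c≤⌈N/2⌉ F₁≢F₂ indist
        with ≢⇒symDiff F₁≢F₂ | any? (λ w → ¬? (w ∈? F₁ ∪ F₂))
      ... | u , u∈symDiff | yes (w , w∉∪) =
        decidable-stable (c ≤? ∣ F₁ ∣ ⊔ ∣ F₂ ∣) λ c≰ → ¬¬-componentOf (F₁ ∩ F₂) u λ (C , spec) →
          let comp = u , symDiff⇒∉∩ u∈symDiff , spec
              C⊆∪ = λ {x} x∈C → indistinguishable-reach indist (proj₁ (spec x) x∈C) (symDiff⇒∈∪ u∈symDiff)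
          in c≰ (begin
            c                                    ≤⟨ cg-≤-partition isCg (indistinguishable-cut indist u∈symDiff w∉∪) comp
                                                                    (indistinguishable-partition comp C⊆∪) ⟩
            ∣ X ∣ + (∣ C ∩ ∁ F₂ ∣ ⊔ ∣ C ∩ ∁ F₁ ∣)  ≡⟨ +-distribˡ-⊔ ∣ X ∣ _ _ ⟩
            (∣ X ∣ + ∣ C ∩ ∁ F₂ ∣) ⊔ (∣ X ∣ + ∣ C ∩ ∁ F₁ ∣)
                                                 ≤⟨ ⊔-mono-≤ (∣p∩q∣+∣r∩∁q∣≤∣p∣ C⊆∪) (∣p∩q∣+∣r∩∁p∣≤∣q∣ C⊆∪) ⟩
            ∣ F₁ ∣ ⊔ ∣ F₂ ∣                      ∎)
        where
        open ≤-Reasoning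
        X = F₁ ∩ F₂
      ... | _ | no none =
        ≤-trans c≤⌈N/2⌉ (∈p∪q⇒⌈n/2⌉≤∣p∣⊔∣q∣ λ w → decidable-stable (w ∈? F₁ ∪ F₂) λ w∉∪ → none (w , w∉∪))

    cg-diagnosable : ∀ {c} → IsCg Γ g c → c ≤ ⌈ N /2⌉ → Diagnosable Γ g (c ∸ 1)
    cg-diagnosable {c} isCg c≤⌈N/2⌉ F₁ F₂ F₁-good F₂-good ∣F₁∣≤ ∣F₂∣≤ F₁≢F₂ with distinguishable? F₁ F₂
    ... | yes distinguishable = distinguishable
    ... | no indist = ⊥-elim (<⇒≱ (n∸1<n (candidate-pos (proj₁ isCg)))
            (≤-trans (cg-≤-indistinguishable F₁-good F₂-good isCg c≤⌈N/2⌉ F₁≢F₂ indist) (⊔-lub ∣F₁∣≤ ∣F₂∣≤)))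

    diagnosable-≤-cg : ∀ {c t} → IsCg Γ g c → Diagnosable Γ g t → t ≤ c ∸ 1
    diagnosable-≤-cg (candidate , _) diagnosable = <⇒≤∸1 (diagnosable-<-candidate diagnosable candidate)

corollary5p1 : (n m : ℕ) (G : Graph n) (H : Graph m) (g : ℕ) →
    Connected G → Connected H → KappaExists (G □ H) g →
    (c : ℕ) → IsCg (G □ H) g c → c ≤ ⌈ n * m /2⌉ →
    IsTg (G □ H) g (c ∸ 1)
corollary5p1 n m G H g _ _ _ c isCg c≤⌈nm/2⌉ =
  cg-diagnosable (G □ H) g isCg c≤⌈nm/2⌉ , λ t → diagnosable-≤-cg (G □ H) g isCg
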